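{- Let $n\ge1$ and let $d=(d_1\le\cdots\le d_k)$ be positive integers with $\sum_i d_i=\binom{n+1}{2}$. Let $G=G(X,Y)$ be the reduced bipartite graph with $X$-degree sequence $d$, i.e. $X=\{x_1,\dots,x_k\}$, $Y=\{y_1,\dots,y_{d_k}\}$, and $x_i$ is adjacent exactly to $y_1,\dots,y_{d_i}$. Then $G$ has a star-forest ascending subgraph decomposition $G=F_1\oplus\cdots\oplus F_n$ in which every vertex of $Y$ has degree at most one in each $F_j$ (i.e. the centres of the stars lie in $X$) if and only if there exists a $(d,n^-)$-ascending matrix $A$ such that the bipartite multigraph $H=H(X,Z)$, $Z=\{z_1,\dots,z_n\}$, whose bipartite adjacency matrix is $A$ (i.e. $x_i$ and $z_j$ are joined by $a_{ij}$ parallel edges) admits a sequential colouring for $X$.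
   Context: $n^-$ denotes the sequence $(1,2,\dots,n)$. For nonnegative integer sequences $d=(d_1,\dots,d_k)$, $b=(b_1,\dots,b_n)$ with equal sums, $\mathcal N(d,b)$ is the set of $k\times n$ matrices with nonnegative integer entries whose $i$-th row sums to $d_i$ and whose $j$-th column sums to $b_j$. For vectors $c,c'\in\mathbb Z^k$, write $c\preceq c'$ if, after sorting the entries of each in nondecreasing order, the $i$-th entry of $c$ is at most the $i$-th entry of $c'$ for every $i$. A matrix $A\in\mathcal N(d,b)$ is $(d,b)$-ascending if its columns satisfy $A_1\preceq A_2\preceq\cdots\preceq A_n$. A bipartite multigraph with degrees $d_1,\dots,d_k$ on the vertices $x_1,\dots,x_k$ of the class $X$ has a sequential colouring for $X$ if it has a proper edge colouring in which the edges incident with $x_i$ receive exactly the colours $\{1,\dots,d_i\}$, for every $i$. An ascending subgraph decomposition of a graph with $\binom{n+1}{2}$ edges is an edge-disjoint decomposition $G_1\oplus\cdots\oplus G_n$ with $|E(G_i)|=i$ and $G_i$ isomorphic to a subgraph of $G_{i+1}$; it is a star-forest ASD if every $G_i$ is a star forest (forest whose components are stars). -}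

module Defs where

open import Data.Nat using (ℕ; zero; suc; _≤_; _<_; _⊔_)
open import Data.Nat.Properties using (≤-decTotalOrder)
open import Data.Fin using (Fin; toℕ)
open import Data.List using (List; map; foldr; allFin)
open import Data.Nat.ListAction using (sum)
open import Data.List.Relation.Binary.Pointwise using (Pointwise)
open import Data.Product using (Σ; _×_; _,_; ∃; proj₁; proj₂)
open import Data.Sum using (_⊎_; inj₁; inj₂)
open import Data.Empty using (⊥)
open import Relation.Binary.PropositionalEquality using (_≡_)
open import Function.Bundles using (_↔_)
open import Function.Definitions using (Injective)
import Data.List.Sort as Sort
open Sort ≤-decTotalOrder using (sort)

-- Vectors are functions Fin k → ℕ.  Indices are 0-based: Fin n index j
-- stands for the paper's index j+1.

Σv : (k : ℕ) → (Fin k → ℕ) → ℕ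
Σv k v = sum (map v (allFin k))

-- maximum entry (0 for the empty vector); for sorted d this is d_k
maxv : (k : ℕ) → (Fin k → ℕ) → ℕ
maxv k v = foldr _⊔_ 0 (map v (allFin k))

_⪯_ : {k : ℕ} → (Fin k → ℕ) → (Fin k → ℕ) → Set
_⪯_ {k} c c' = Pointwise _≤_ (sort (map c (allFin k))) (sort (map c' (allFin k)))

Next : {n : ℕ} → Fin n → Fin n → Set
Next j j' = toℕ j' ≡ suc (toℕ j)

Matrix : ℕ → ℕ → Set
Matrix k n = Fin k → Fin n → ℕ

column : {k n : ℕ} → Matrix k n → Fin n → (Fin k → ℕ)
column A j i = A i j

InN : (n k : ℕ) (d : Fin k → ℕ) → Matrix k n → Set
InN n k d A = (∀ i → Σv n (A i) ≡ d i) × (∀ j → Σv k (column A j) ≡ suc (toℕ j))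

Ascending : (n k : ℕ) (d : Fin k → ℕ) → Matrix k n → Set
Ascending n k d A =
  InN n k d A × (∀ (j j' : Fin n) → Next j j' → column A j ⪯ column A j')

-- The bipartite multigraph H(X,Z) with adjacency matrix A:
-- edges are triples (i, j, t) with t < a_ij (t-th parallel edge x_i z_j)

EdgeH : {k n : ℕ} → Matrix k n → Set
EdgeH {k} {n} A = Σ (Fin k) λ i → Σ (Fin n) λ j → Fin (A i j)

xOf : {k n : ℕ} {A : Matrix k n} → EdgeH A → Fin k
xOf (i , _ , _) = i

zOf : {k n : ℕ} {A : Matrix k n} → EdgeH A → Fin n
zOf (_ , j , _) = j

Proper : {k n : ℕ} (A : Matrix k n) → (EdgeH A → ℕ) → Set
Proper A col = ∀ e e' → (xOf e ≡ xOf e' ⊎ zOf e ≡ zOf e') → col e ≡ col e' → e ≡ e'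

SequentialColouring : {k n : ℕ} (d : Fin k → ℕ) (A : Matrix k n) → Set
SequentialColouring {k} d A = Σ (EdgeH A → ℕ) λ col →
    Proper A col
  × (∀ e → 1 ≤ col e × col e ≤ d (xOf e))
  × (∀ (i : Fin k) (c : ℕ) → 1 ≤ c → c ≤ d i → Σ (EdgeH A) λ e → xOf e ≡ i × col e ≡ c)

-- The reduced bipartite graph G(X,Y) with X-degree sequence d:
-- X = Fin k, Y = Fin (maxv k d); x_i ~ y_t iff t < d_i.
-- Edges of G are pairs (i, t) with t : Fin (d i).

EdgeG : (k : ℕ) → (Fin k → ℕ) → Set
EdgeG k d = Σ (Fin k) λ i → Fin (d i)

VertG : (k : ℕ) → (Fin k → ℕ) → Set
VertG k d = Fin k ⊎ Fin (maxv k d)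

-- a decomposition G = F_1 ⊕ … ⊕ F_n is an assignment of each edge to one part
Decomp : (n k : ℕ) → (Fin k → ℕ) → Set
Decomp n k d = EdgeG k d → Fin n

AdjPart : {n k : ℕ} {d : Fin k → ℕ} → Decomp n k d → Fin n →
          VertG k d → VertG k d → Set
AdjPart {d = d} c j (inj₁ i) (inj₂ y) = Σ (Fin (d i)) λ t → toℕ t ≡ toℕ y × c (i , t) ≡ j
AdjPart {d = d} c j (inj₂ y) (inj₁ i) = Σ (Fin (d i)) λ t → toℕ t ≡ toℕ y × c (i , t) ≡ j
AdjPart c j (inj₁ _) (inj₁ _) = ⊥
AdjPart c j (inj₂ _) (inj₂ _) = ⊥

EmbedsInto : {n k : ℕ} {d : Fin k → ℕ} → Decomp n k d → Fin n → Fin n → Set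
EmbedsInto {k = k} {d = d} c j j' =
  Σ (VertG k d → VertG k d) λ φ →
    Injective _≡_ _≡_ φ × (∀ u v → AdjPart c j u v → AdjPart c j' (φ u) (φ v))

PartSize : {n k : ℕ} {d : Fin k → ℕ} → Decomp n k d → Fin n → Set
PartSize {k = k} {d = d} c j = (Σ (EdgeG k d) λ e → c e ≡ j) ↔ Fin (suc (toℕ j))

YDegAtMostOne : {n k : ℕ} {d : Fin k → ℕ} → Decomp n k d → Set
YDegAtMostOne {d = d} c = ∀ (e e' : EdgeG _ d) → c e ≡ c e' →
  toℕ (proj₂ e) ≡ toℕ (proj₂ e') → e ≡ e'

-- Characterisation used: a graph is a star
-- forest iff every edge has an endpoint of degree one.  For the edge
-- e = (x_i, y_t) of F_(c e): either y_t or x_i has no other edge in that part.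
StarForestParts : {n k : ℕ} {d : Fin k → ℕ} → Decomp n k d → Set
StarForestParts {d = d} c = ∀ (e : EdgeG _ d) →
    (∀ e' → c e' ≡ c e → toℕ (proj₂ e') ≡ toℕ (proj₂ e) → e' ≡ e)
  ⊎ (∀ e' → c e' ≡ c e → proj₁ e' ≡ proj₁ e → e' ≡ e)

XCentredStarASD : (n k : ℕ) → (Fin k → ℕ) → Set
XCentredStarASD n k d = Σ (Decomp n k d) λ c →
    (∀ j → PartSize c j)
  × (∀ j j' → Next j j' → EmbedsInto c j j')
  × StarForestParts c
  × YDegAtMostOne c

{-# OPTIONS --safe #-}
module Submission where

-- Reading the edge of x_i with colour t + 1 as the edge x_i y_t of G, and its end z_j as the
-- part F_j containing it, identifies such colourings with decompositions of G in which a_ij is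
-- the size of the star of F_j centred at x_i. Under this identification, properness at Z says
-- that every y has degree at most one in every F_j, so each F_j is a star forest centred in X,
-- and the column sums are the sizes of the parts. It remains to see that F_j embeds in F_j'
-- iff column j ⪯ column j'. An embedding sends every star into a star at least as large (a
-- star whose centre lands in Y has a single edge) and different stars to different stars, so
-- for every v there are at least as many stars with ≥ v edges in F_j' as in F_j, which after
-- sorting is ⪯. Conversely ⪯ yields a permutation σ of X with a_ij ≤ a_σ(i)j', matching the
-- largest entries greedily; sending the leaves of x_i to leaves of x_σ(i) is injective on Y
-- and extends to a permutation of Y.

open import Defs
open import Axiom.UniquenessOfIdentityProofs using (module Decidable⇒UIP)
open import Data.Bool using (if_then_else_)
open import Data.Empty using (⊥-elim)
open import Data.Fin using (Fin; zero; suc; toℕ; fromℕ<; inject≤; punchIn; punchOut; _≟_)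
open import Data.Fin.Properties
  using (+↔⊎; injective⇒≤; toℕ-injective; toℕ<n; toℕ-fromℕ<; toℕ-inject≤; inject≤-injective;
         punchIn-punchOut; 0≢1+n)
  renaming (suc-injective to suc-injectiveᶠ)
open import Data.Fin.Permutation
  using (Permutation; _⟨$⟩ʳ_; _∘ₚ_; insert; insert-punchIn; transpose; cast-id; ↔⇒≡)
import Data.Fin.Permutation as Perm
import Data.Fin.Permutation.Components as PC
open import Data.List using (List; []; _∷_; map; foldr; allFin; filter; length)
open import Data.List.Properties
  using (map-tabulate; length-map; length-filter; filter-all; filter-accept; filter-reject)
open import Data.List.Relation.Binary.Pointwise using (Pointwise; []; _∷_)
open import Data.List.Relation.Binary.Permutation.Propositional using (_↭_)
open import Data.List.Relation.Binary.Permutation.Propositional.Properties using (↭-length; filter-↭)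
open import Data.List.Relation.Unary.All as All using (All)
open import Data.List.Relation.Unary.Linked as Linked using (Linked)
open import Data.List.Relation.Unary.Linked.Properties using (Linked⇒All)
import Data.List.Sort as Sort
open import Data.Nat using (ℕ; zero; suc; _+_; _≤_; _<_; _⊔_; _≤?_; z≤n; s≤s; s≤s⁻¹)
open import Data.Nat.Combinatorics using (_C_)
open import Data.Nat.ListAction using (sum)
open import Data.Nat.Properties
  using (+-commutativeSemigroup; m≤m⊔n; m≤n⊔m; ≤-trans; ≤-refl; ≤-irrelevant; ≤-decTotalOrder;
         m≤n⇒m≤1+n; <-irrefl; ≰⇒>; <⇒≤; suc-injective; module ≤-Reasoning)
open import Algebra.Properties.CommutativeSemigroup +-commutativeSemigroup using (x∙yz≈y∙xz)
open import Data.Product using (Σ; _×_; _,_; proj₁; proj₂)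
open import Data.Product.Function.Dependent.Propositional using (Σ-↔)
open import Data.Product.Properties using (,-injectiveʳ-UIP)
open import Data.Sum using (_⊎_; inj₁; inj₂)
open import Data.Sum.Function.Propositional using (_⊎-↔_)
open import Data.Sum.Properties using (inj₁-injective; inj₂-injective)
open import Function using (_∘_; id)
open import Function.Bundles using (_↔_; _⇔_; mk↔ₛ′; mk⇔; Inverse; Injection)
open import Function.Construct.Identity using (↔-id)
open import Function.Definitions using (Injective)
open import Function.Properties.Inverse using (↔-trans; ↔-sym; ↔⇒↣)
open import Function.Related.TypeIsomorphisms using (Σ-assoc)
open import Level using (0ℓ)
open import Relation.Binary.PropositionalEquality
open import Relation.Nullary using (Dec; yes; no; does; ¬_; Irrelevant)
open import Relation.Nullary.Decidable using (dec-true; dec-false; decidable-stable)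
open import Relation.Unary using (Pred; Decidable)
import Relation.Unary as U

open Inverse
open Sort ≤-decTotalOrder using (sort; sort-↭; sort-↗)

map-allFin-suc : ∀ {A : Set} {k} (v : Fin (suc k) → A) →
                 map v (allFin (suc k)) ≡ v zero ∷ map (v ∘ suc) (allFin k)
map-allFin-suc v = cong (v zero ∷_) (trans (map-tabulate suc v) (sym (map-tabulate id (v ∘ suc))))

Σv-suc : ∀ k (a : Fin (suc k) → ℕ) → Σv (suc k) a ≡ a zero + Σv k (a ∘ suc)
Σv-suc k a = cong sum (map-allFin-suc a)

maxv-suc : ∀ k (a : Fin (suc k) → ℕ) → maxv (suc k) a ≡ a zero ⊔ maxv k (a ∘ suc)
maxv-suc k a = cong (foldr _⊔_ 0) (map-allFin-suc a)

≤maxv : ∀ k (a : Fin k → ℕ) i → a i ≤ maxv k a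
≤maxv (suc k) a zero    rewrite maxv-suc k a = m≤m⊔n _ _
≤maxv (suc k) a (suc i) rewrite maxv-suc k a = ≤-trans (≤maxv k (a ∘ suc) i) (m≤n⊔m (a zero) _)

Σv-punchIn : ∀ k (a : Fin (suc k) → ℕ) i → Σv (suc k) a ≡ a i + Σv k (a ∘ punchIn i)
Σv-punchIn k       a zero    = Σv-suc k a
Σv-punchIn (suc k) a (suc i) = begin
  Σv (suc (suc k)) a                                 ≡⟨ Σv-suc (suc k) a ⟩
  a zero + Σv (suc k) (a ∘ suc)                      ≡⟨ cong (a zero +_) (Σv-punchIn k (a ∘ suc) i) ⟩
  a zero + (a (suc i) + Σv k (a ∘ suc ∘ punchIn i))  ≡⟨ x∙yz≈y∙xz (a zero) (a (suc i)) _ ⟩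
  a (suc i) + (a zero + Σv k (a ∘ suc ∘ punchIn i))  ≡⟨ cong (a (suc i) +_) (Σv-suc k (a ∘ punchIn (suc i))) ⟨
  a (suc i) + Σv (suc k) (a ∘ punchIn (suc i))       ∎
  where open ≡-Reasoning

Σ-Fin-suc-↔ : ∀ {k} (B : Fin (suc k) → Set) → Σ (Fin (suc k)) B ↔ (B zero ⊎ Σ (Fin k) (B ∘ suc))
Σ-Fin-suc-↔ B = mk↔ₛ′
  (λ { (zero , b) → inj₁ b ; (suc i , b) → inj₂ (i , b) })
  (λ { (inj₁ b) → zero , b ; (inj₂ (i , b)) → suc i , b })
  (λ { (inj₁ b) → refl ; (inj₂ (i , b)) → refl })
  (λ { (zero , b) → refl ; (suc i , b) → refl })

Σ-Fin-↔ : ∀ k (a : Fin k → ℕ) → Σ (Fin k) (Fin ∘ a) ↔ Fin (Σv k a)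
Σ-Fin-↔ zero    a = mk↔ₛ′ (λ ()) (λ ()) (λ ()) (λ ())
Σ-Fin-↔ (suc k) a =
  ↔-trans (Σ-Fin-suc-↔ (Fin ∘ a))
  (↔-trans (↔-id _ ⊎-↔ Σ-Fin-↔ k (a ∘ suc))
  (↔-trans (↔-sym +↔⊎)
  (cast-id (sym (Σv-suc k a)))))

↔-to-injective : ∀ {A B : Set} (f : A ↔ B) → Injective _≡_ _≡_ (to f)
↔-to-injective f = Injection.injective (↔⇒↣ f)

injection⇒≤ : ∀ {A B : Set} {a b} → A ↔ Fin a → B ↔ Fin b →
              (f : A → B) → Injective _≡_ _≡_ f → a ≤ b
injection⇒≤ α β f f-inj = injective⇒≤ λ eq →
  ↔-to-injective (↔-sym α) (f-inj (↔-to-injective β eq))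

Σ-≡-irrelevant : ∀ {A : Set} {P : Pred A 0ℓ} → U.Irrelevant P →
                 {x y : Σ A P} → proj₁ x ≡ proj₁ y → x ≡ y
Σ-≡-irrelevant irr {a , p} {.a , q} refl = cong (a ,_) (irr p q)

Fin-≡-irrelevant : ∀ {m} {x y : Fin m} → Irrelevant (x ≡ y)
Fin-≡-irrelevant = Decidable⇒UIP.≡-irrelevant _≟_

Σ-Fin-≡ : ∀ {I : Set} {a : I → ℕ} {x y : Σ I (Fin ∘ a)} →
          proj₁ x ≡ proj₁ y → toℕ (proj₂ x) ≡ toℕ (proj₂ y) → x ≡ y
Σ-Fin-≡ {x = i , s} {.i , s′} refl eq = cong (i ,_) (toℕ-injective eq)

Σ-fibres-↔ : ∀ {I J : Set} (f : I → J) → (Σ J λ j → Σ I λ i → f i ≡ j) ↔ I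
Σ-fibres-↔ f = mk↔ₛ′ (proj₁ ∘ proj₂) (λ i → f i , i , refl) (λ _ → refl) (λ { (_ , _ , refl) → refl })

Σ-proj₁-fibre-↔ : ∀ {I : Set} {B : I → Set} (i : I) → (Σ (Σ I B) λ x → proj₁ x ≡ i) ↔ B i
Σ-proj₁-fibre-↔ i =
  mk↔ₛ′ (λ { ((_ , b) , refl) → b }) (λ b → (i , b) , refl) (λ _ → refl) (λ { (_ , refl) → refl })

-- Counting decidable subsets of Fin m

count : ∀ {m} {P : Pred (Fin m) 0ℓ} → Decidable P → ℕ
count {m} P? = Σv m (λ t → if does (P? t) then 1 else 0)

Dec-↔-Fin : ∀ {A : Set} → Irrelevant A → (a? : Dec A) → A ↔ Fin (if does a? then 1 else 0)
Dec-↔-Fin irr (yes a) = mk↔ₛ′ (λ _ → zero) (λ _ → a) (λ { zero → refl }) (irr a)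
Dec-↔-Fin irr (no ¬a) = mk↔ₛ′ (λ a → ⊥-elim (¬a a)) (λ ()) (λ ()) (λ a → ⊥-elim (¬a a))

count-↔ : ∀ {m} {P : Pred (Fin m) 0ℓ} (P? : Decidable P) → U.Irrelevant P →
          Σ (Fin m) P ↔ Fin (count P?)
count-↔ P? irr = ↔-trans (Σ-↔ (↔-id _) (Dec-↔-Fin irr (P? _))) (Σ-Fin-↔ _ _)

count-mono : ∀ {m m′} {P : Pred (Fin m) 0ℓ} {Q : Pred (Fin m′) 0ℓ}
             (P? : Decidable P) (Q? : Decidable Q) → U.Irrelevant P → U.Irrelevant Q →
             (f : Σ (Fin m) P → Σ (Fin m′) Q) →
             (∀ {x y} → proj₁ (f x) ≡ proj₁ (f y) → proj₁ x ≡ proj₁ y) →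
             count P? ≤ count Q?
count-mono P? Q? irrP irrQ f f-inj =
  injection⇒≤ (count-↔ P? irrP) (count-↔ Q? irrQ) f (λ eq → Σ-≡-irrelevant irrP (f-inj (cong proj₁ eq)))

count-witness : ∀ {m} {P : Pred (Fin m) 0ℓ} (P? : Decidable P) → U.Irrelevant P →
                0 < count P? → Σ (Fin m) P
count-witness P? irr pos = from (count-↔ P? irr) (fromℕ< pos)

count-punchIn : ∀ {m} {P : Pred (Fin (suc m)) 0ℓ} (P? : Decidable P) {i} → P i →
                count P? ≡ suc (count (P? ∘ punchIn i))
count-punchIn P? {i} p =
  trans (Σv-punchIn _ _ i) (cong (λ b → (if b then 1 else 0) + count (P? ∘ punchIn i)) (dec-true (P? i) p))

-- Threshold counts and the order ⪯

#≥ : ℕ → List ℕ → ℕ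
#≥ v xs = length (filter (v ≤?_) xs)

#≥-↭ : ∀ v {xs ys} → xs ↭ ys → #≥ v xs ≡ #≥ v ys
#≥-↭ v p = ↭-length (filter-↭ (v ≤?_) p)

#≥-accept : ∀ {v x} xs → v ≤ x → #≥ v (x ∷ xs) ≡ suc (#≥ v xs)
#≥-accept {v} _ v≤x = cong length (filter-accept (v ≤?_) v≤x)

#≥-reject : ∀ {v x} xs → ¬ v ≤ x → #≥ v (x ∷ xs) ≡ #≥ v xs
#≥-reject {v} _ v≰x = cong length (filter-reject (v ≤?_) v≰x)

#≥-mono : ∀ v {xs ys} → Pointwise _≤_ xs ys → #≥ v xs ≤ #≥ v ys
#≥-mono v [] = z≤n
#≥-mono v (_∷_ {x} {y} {xs} {ys} x≤y ps) = step (v ≤? x) (v ≤? y)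
  where
  step : Dec (v ≤ x) → Dec (v ≤ y) → #≥ v (x ∷ xs) ≤ #≥ v (y ∷ ys)
  step (yes v≤x) (yes v≤y) = subst₂ _≤_ (sym (#≥-accept xs v≤x)) (sym (#≥-accept ys v≤y)) (s≤s (#≥-mono v ps))
  step (yes v≤x) (no v≰y)  = ⊥-elim (v≰y (≤-trans v≤x x≤y))
  step (no v≰x)  (yes v≤y) =
    subst₂ _≤_ (sym (#≥-reject xs v≰x)) (sym (#≥-accept ys v≤y)) (m≤n⇒m≤1+n (#≥-mono v ps))
  step (no v≰x)  (no v≰y)  = subst₂ _≤_ (sym (#≥-reject xs v≰x)) (sym (#≥-reject ys v≰y)) (#≥-mono v ps)

#≥-all : ∀ {v xs} → All (v ≤_) xs → #≥ v xs ≡ length xs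
#≥-all {v} all = cong length (filter-all (v ≤?_) all)

#≥-mono⇒Pointwise : ∀ {xs ys} → Linked _≤_ xs → Linked _≤_ ys → length xs ≡ length ys →
                    (∀ v → #≥ v xs ≤ #≥ v ys) → Pointwise _≤_ xs ys
#≥-mono⇒Pointwise {[]}     {[]}     _   _   _   _   = []
#≥-mono⇒Pointwise {x ∷ xs} {y ∷ ys} xs↗ ys↗ len dom =
  x≤y ∷ #≥-mono⇒Pointwise (Linked.tail xs↗) (Linked.tail ys↗) len′ tails
  where
  open ≤-Reasoning
  len′ : length xs ≡ length ys
  len′ = suc-injective len

  x≤y : x ≤ y
  x≤y = decidable-stable (x ≤? y) λ x≰y → <-irrefl refl (begin
    suc (length xs)  ≡⟨ #≥-all (Linked⇒All ≤-trans ≤-refl xs↗) ⟨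
    #≥ x (x ∷ xs)    ≤⟨ dom x ⟩
    #≥ x (y ∷ ys)    ≡⟨ #≥-reject ys x≰y ⟩
    #≥ x ys          ≤⟨ length-filter (x ≤?_) ys ⟩
    length ys        ≡⟨ len′ ⟨
    length xs        ∎)

  tails : ∀ v → #≥ v xs ≤ #≥ v ys
  tails v = step (v ≤? x) (v ≤? y)
    where
    step : Dec (v ≤ x) → Dec (v ≤ y) → #≥ v xs ≤ #≥ v ys
    step (yes v≤x) (yes v≤y) = s≤s⁻¹ (subst₂ _≤_ (#≥-accept xs v≤x) (#≥-accept ys v≤y) (dom v))
    step (yes v≤x) (no v≰y)  = ⊥-elim (v≰y (≤-trans v≤x x≤y))
    step (no _)    (yes v≤y) = begin
      #≥ v xs    ≤⟨ length-filter (v ≤?_) xs ⟩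
      length xs  ≡⟨ len′ ⟩
      length ys  ≡⟨ #≥-all (All.tail (Linked⇒All ≤-trans v≤y ys↗)) ⟨
      #≥ v ys    ∎
    step (no v≰x)  (no v≰y)  = subst₂ _≤_ (#≥-reject xs v≰x) (#≥-reject ys v≰y) (dom v)

#≥ᵛ : ∀ {k} → ℕ → (Fin k → ℕ) → ℕ
#≥ᵛ v c = count (λ i → v ≤? c i)

#≥-map-allFin : ∀ v k (c : Fin k → ℕ) → #≥ v (map c (allFin k)) ≡ #≥ᵛ v c
#≥-map-allFin v zero    c = refl
#≥-map-allFin v (suc k) c =
  trans (cong (#≥ v) (map-allFin-suc c)) (trans (head (v ≤? c zero)) (sym (Σv-suc k _)))
  where
  indicator : ∀ {b} → does (v ≤? c zero) ≡ b →
              (if b then 1 else 0) + #≥ᵛ v (c ∘ suc) ≡ (if does (v ≤? c zero) then 1 else 0) + #≥ᵛ v (c ∘ suc)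
  indicator eq = cong (λ b → (if b then 1 else 0) + #≥ᵛ v (c ∘ suc)) (sym eq)

  head : Dec (v ≤ c zero) →
         #≥ v (c zero ∷ map (c ∘ suc) (allFin k)) ≡ (if does (v ≤? c zero) then 1 else 0) + #≥ᵛ v (c ∘ suc)
  head (yes v≤c₀) = trans (#≥-accept _ v≤c₀)
    (trans (cong suc (#≥-map-allFin v k (c ∘ suc))) (indicator (dec-true (v ≤? c zero) v≤c₀)))
  head (no v≰c₀) = trans (#≥-reject _ v≰c₀)
    (trans (#≥-map-allFin v k (c ∘ suc)) (indicator (dec-false (v ≤? c zero) v≰c₀)))

#≥-sort : ∀ v {k} (c : Fin k → ℕ) → #≥ v (sort (map c (allFin k))) ≡ #≥ᵛ v c
#≥-sort v {k} c = trans (#≥-↭ v (sort-↭ _)) (#≥-map-allFin v k c)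

⪯⇒#≥ᵛ-mono : ∀ {k} {c c′ : Fin k → ℕ} → c ⪯ c′ → ∀ v → #≥ᵛ v c ≤ #≥ᵛ v c′
⪯⇒#≥ᵛ-mono {c = c} {c′} c⪯c′ v = subst₂ _≤_ (#≥-sort v c) (#≥-sort v c′) (#≥-mono v c⪯c′)

#≥ᵛ-mono⇒⪯ : ∀ {k} {c c′ : Fin k → ℕ} → (∀ v → #≥ᵛ v c ≤ #≥ᵛ v c′) → c ⪯ c′
#≥ᵛ-mono⇒⪯ {k} {c} {c′} dom =
  #≥-mono⇒Pointwise (sort-↗ _) (sort-↗ _) same-length
    (λ v → subst₂ _≤_ (sym (#≥-sort v c)) (sym (#≥-sort v c′)) (dom v))
  where
  length-sort : (a : Fin k → ℕ) → length (sort (map a (allFin k))) ≡ length (allFin k)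
  length-sort a = trans (↭-length (sort-↭ _)) (length-map a (allFin k))
  same-length : length (sort (map c (allFin k))) ≡ length (sort (map c′ (allFin k)))
  same-length = trans (length-sort c) (sym (length-sort c′))

argmax : ∀ {k} (c : Fin (suc k) → ℕ) → Σ (Fin (suc k)) λ i → ∀ j → c j ≤ c i
argmax {zero}  c = zero , λ { zero → ≤-refl }
argmax {suc k} c with argmax (c ∘ suc)
... | i , max with c zero ≤? c (suc i)
...   | yes c₀≤ = suc i , λ { zero → c₀≤ ; (suc j) → max j }
...   | no c₀≰  = zero , λ { zero → ≤-refl ; (suc j) → ≤-trans (max j) (<⇒≤ (≰⇒> c₀≰)) }

insert-here : ∀ {m n} i j (π : Permutation m n) → insert i j π ⟨$⟩ʳ i ≡ j
insert-here i j π with i ≟ i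
... | yes _   = refl
... | no i≢i  = ⊥-elim (i≢i refl)

-- Greedy matching: the largest entry of c is served by the largest entry of c′, and the
-- threshold counts of the remaining entries still dominate.
dominating-permutation : ∀ {k} {c c′ : Fin k → ℕ} → (∀ v → #≥ᵛ v c ≤ #≥ᵛ v c′) →
                         Σ (Permutation k k) λ σ → ∀ i → c i ≤ c′ (σ ⟨$⟩ʳ i)
dominating-permutation {zero}          _   = Perm.id , λ ()
dominating-permutation {suc k} {c} {c′} dom = insert i₀ i₀′ σ , dominated
  where
  i₀ i₀′ : Fin (suc k)
  i₀ = proj₁ (argmax c)
  i₀′ = proj₁ (argmax c′)

  top : c i₀ ≤ c′ i₀′
  top = ≤-trans (proj₂ witness) (proj₂ (argmax c′) (proj₁ witness))
    where
    witness : Σ (Fin (suc k)) λ i → c i₀ ≤ c′ i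
    witness = count-witness (λ i → c i₀ ≤? c′ i) ≤-irrelevant
      (≤-trans (s≤s z≤n) (subst (_≤ #≥ᵛ (c i₀) c′) (count-punchIn (λ i → c i₀ ≤? c i) ≤-refl) (dom (c i₀))))

  dom′ : ∀ v → #≥ᵛ v (c ∘ punchIn i₀) ≤ #≥ᵛ v (c′ ∘ punchIn i₀′)
  dom′ v with v ≤? c i₀
  ... | yes v≤ = s≤s⁻¹ (subst₂ _≤_ (count-punchIn (λ i → v ≤? c i) v≤)
                                    (count-punchIn (λ i → v ≤? c′ i) (≤-trans v≤ top)) (dom v))
  ... | no v≰  = count-mono (λ i → v ≤? c (punchIn i₀ i)) (λ i → v ≤? c′ (punchIn i₀′ i))
                   ≤-irrelevant ≤-irrelevant
                   (λ (_ , v≤) → ⊥-elim (too-big v≤)) (λ {(_ , v≤)} _ → ⊥-elim (too-big v≤))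
    where
    too-big : ∀ {i} → ¬ v ≤ c i
    too-big v≤ = v≰ (≤-trans v≤ (proj₂ (argmax c) _))

  σ : Permutation k k
  σ = proj₁ (dominating-permutation dom′)

  dominated : ∀ i → c i ≤ c′ (insert i₀ i₀′ σ ⟨$⟩ʳ i)
  dominated i = by-cases (i₀ ≟ i)
    where
    by-cases : Dec (i₀ ≡ i) → c i ≤ c′ (insert i₀ i₀′ σ ⟨$⟩ʳ i)
    by-cases (yes refl) = subst (c i₀ ≤_) (cong c′ (sym (insert-here i₀ i₀′ σ))) top
    by-cases (no i₀≢i)  = subst (λ j → c j ≤ c′ (insert i₀ i₀′ σ ⟨$⟩ʳ j)) (punchIn-punchOut i₀≢i)
                            (subst (c (punchIn i₀ r) ≤_) (cong c′ (sym (insert-punchIn i₀ i₀′ σ r)))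
                              (proj₂ (dominating-permutation dom′) r))
      where r = punchOut i₀≢i

⪯⇒dominating-permutation : ∀ {k} {c c′ : Fin k → ℕ} → c ⪯ c′ →
                           Σ (Permutation k k) λ σ → ∀ i → c i ≤ c′ (σ ⟨$⟩ʳ i)
⪯⇒dominating-permutation c⪯c′ = dominating-permutation (⪯⇒#≥ᵛ-mono c⪯c′)

transpose-here : ∀ {m} (i j : Fin m) → PC.transpose i j i ≡ j
transpose-here i j rewrite dec-true (i ≟ i) refl = refl

transpose-elsewhere : ∀ {m} {i j k : Fin m} → k ≢ i → k ≢ j → PC.transpose i j k ≡ k
transpose-elsewhere {i = i} {j} {k} k≢i k≢j rewrite dec-false (k ≟ i) k≢i | dec-false (k ≟ j) k≢j = refl

extend-injection : ∀ {a m} (g h : Fin a → Fin m) → Injective _≡_ _≡_ g → Injective _≡_ _≡_ h →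
                   Σ (Permutation m m) λ π → ∀ r → π ⟨$⟩ʳ g r ≡ h r
extend-injection {zero}  g h _     _     = Perm.id , λ ()
extend-injection {suc a} {m} g h g-inj h-inj = π ∘ₚ transpose (π ⟨$⟩ʳ g zero) (h zero) , extends
  where
  rec : Σ (Permutation m m) λ π → ∀ r → π ⟨$⟩ʳ g (suc r) ≡ h (suc r)
  rec = extend-injection (g ∘ suc) (h ∘ suc) (suc-injectiveᶠ ∘ g-inj) (suc-injectiveᶠ ∘ h-inj)
  π : Permutation m m
  π = proj₁ rec
  extends : ∀ r → PC.transpose (π ⟨$⟩ʳ g zero) (h zero) (π ⟨$⟩ʳ g r) ≡ h r
  extends zero    = transpose-here (π ⟨$⟩ʳ g zero) (h zero)
  extends (suc r) = trans (cong (PC.transpose _ _) (proj₂ rec r))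
    (transpose-elsewhere
      (λ eq → 0≢1+n (sym (g-inj (↔-to-injective π (trans (proj₂ rec r) eq)))))
      (λ eq → 0≢1+n (sym (h-inj eq))))

-- Decompositions of G and the multigraph H

variable
  n k : ℕ
  d : Fin k → ℕ

Leaves : Decomp n k d → Fin k → Fin n → Set
Leaves {d = d} c i j = Σ (Fin (d i)) λ t → c (i , t) ≡ j

DegreeMatrix : Decomp n k d → Matrix k n → Set
DegreeMatrix c A = ∀ i j → Fin (A i j) ↔ Leaves c i j

Star : Matrix k n → Fin k → Set
Star {n = n} A i = Σ (Fin n) λ j → Fin (A i j)

-- κ i numbers the edges of H at x_i by 0, …, d_i − 1; the edge numbered t stands for the
-- edge x_i y_t of G and has colour t + 1.
Numbering : (Fin k → ℕ) → Matrix k n → Set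
Numbering d A = ∀ i → Star A i ↔ Fin (d i)

partOf : {A : Matrix k n} → Numbering d A → Decomp n k d
partOf κ (i , t) = proj₁ (from (κ i) t)

colouringOf : {A : Matrix k n} → Numbering d A → EdgeH A → ℕ
colouringOf κ (i , x) = suc (toℕ (to (κ i) x))

partOf-degreeMatrix : {A : Matrix k n} (κ : Numbering d A) → DegreeMatrix (partOf κ) A
partOf-degreeMatrix κ i j = ↔-sym (↔-trans (Σ-↔ (↔-sym (κ i)) (↔-id _)) (Σ-proj₁-fibre-↔ j))

degreeMatrix⇒numbering : {A : Matrix k n} {c : Decomp n k d} → DegreeMatrix c A → Numbering d A
degreeMatrix⇒numbering {c = c} deg i = ↔-trans (Σ-↔ (↔-id _) (deg i _)) (Σ-fibres-↔ (λ t → c (i , t)))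

numbering⇒rowSums : {A : Matrix k n} → Numbering d A → ∀ i → Σv n (A i) ≡ d i
numbering⇒rowSums {A = A} κ i = ↔⇒≡ (↔-trans (↔-sym (Σ-Fin-↔ _ (A i))) (κ i))

part-↔ : {A : Matrix k n} {c : Decomp n k d} → DegreeMatrix c A → ∀ j →
         (Σ (EdgeG k d) λ g → c g ≡ j) ↔ Fin (Σv k (column A j))
part-↔ {k = k} {A = A} {c = c} deg j =
  ↔-trans (Σ-assoc {C = λ i t → c (i , t) ≡ j})
  (↔-trans (Σ-↔ (↔-id _) (↔-sym (deg _ j)))
  (Σ-Fin-↔ k (column A j)))

numbering⇒sequential : {A : Matrix k n} (κ : Numbering d A) → YDegAtMostOne (partOf κ) →
                       SequentialColouring d A
numbering⇒sequential {d = d} {A = A} κ ydeg = colouringOf κ , proper , (λ _ → s≤s z≤n , toℕ<n _) , onto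
  where
  same-colour : ∀ {i i′} {x : Star A i} {x′ : Star A i′} → i ≡ i′ →
                toℕ (to (κ i) x) ≡ toℕ (to (κ i′) x′) → _≡_ {A = EdgeH A} (i , x) (i′ , x′)
  same-colour refl eq = cong (_ ,_) (↔-to-injective (κ _) (toℕ-injective eq))

  proper : Proper A (colouringOf κ)
  proper (i , x) (i′ , x′) (inj₁ same-x) eq = same-colour same-x (suc-injective eq)
  proper (i , x) (i′ , x′) (inj₂ same-z) eq = same-colour (cong proj₁ same-edge) same-number
    where
    same-number : toℕ (to (κ i) x) ≡ toℕ (to (κ i′) x′)
    same-number = suc-injective eq
    same-part : proj₁ (from (κ i) (to (κ i) x)) ≡ proj₁ (from (κ i′) (to (κ i′) x′))
    same-part = trans (cong proj₁ (strictlyInverseʳ (κ i) x))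
                      (trans same-z (sym (cong proj₁ (strictlyInverseʳ (κ i′) x′))))
    same-edge : _≡_ {A = EdgeG _ d} (i , to (κ i) x) (i′ , to (κ i′) x′)
    same-edge = ydeg _ _ same-part same-number

  onto : ∀ i v → 1 ≤ v → v ≤ d i → Σ (EdgeH A) λ e → xOf e ≡ i × colouringOf κ e ≡ v
  onto i (suc v) _ v<dᵢ = (i , from (κ i) (fromℕ< v<dᵢ)) , refl ,
    cong suc (trans (cong toℕ (strictlyInverseˡ (κ i) _)) (toℕ-fromℕ< v<dᵢ))

sequential⇒numbering : {A : Matrix k n} → SequentialColouring d A →
                       Σ (Numbering d A) λ κ → YDegAtMostOne (partOf κ)
sequential⇒numbering {d = d} {A = A} (col , proper , range , onto) = κ , ydeg
  where
  below : ∀ {v m} → 1 ≤ v × v ≤ m → Σ (Fin m) λ t → suc (toℕ t) ≡ v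
  below {suc v} (_ , v<m) = fromℕ< v<m , cong suc (toℕ-fromℕ< v<m)

  number : ∀ e → Fin (d (xOf e))
  number e = proj₁ (below (range e))

  suc-number : ∀ e → suc (toℕ (number e)) ≡ col e
  suc-number e = proj₂ (below (range e))

  atColour : ∀ i (t : Fin (d i)) → Σ (Star A i) λ x → col (i , x) ≡ suc (toℕ t)
  atColour i t = here (onto i (suc (toℕ t)) (s≤s z≤n) (toℕ<n t))
    where
    here : ∀ {v} → (Σ (EdgeH A) λ e → xOf e ≡ i × col e ≡ v) → Σ (Star A i) λ x → col (i , x) ≡ v
    here ((.i , x) , refl , colour) = x , colour

  κ : Numbering d A
  κ i = mk↔ₛ′ (λ x → number (i , x)) (λ t → proj₁ (atColour i t)) number-atColour atColour-number
    where
    number-atColour : ∀ t → number (i , proj₁ (atColour i t)) ≡ t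
    number-atColour t = toℕ-injective (suc-injective (trans (suc-number _) (proj₂ (atColour i t))))
    atColour-number : ∀ x → proj₁ (atColour i (number (i , x))) ≡ x
    atColour-number x = ,-injectiveʳ-UIP Fin-≡-irrelevant
      (proper _ _ (inj₁ refl) (trans (proj₂ (atColour i _)) (suc-number (i , x))))

  ydeg : YDegAtMostOne (partOf κ)
  ydeg (i , t) (i′ , t′) same-part same-y = Σ-Fin-≡ (cong proj₁ same-edge) same-y
    where
    same-edge : _≡_ {A = EdgeH A} (i , proj₁ (atColour i t)) (i′ , proj₁ (atColour i′ t′))
    same-edge = proper _ _ (inj₂ same-part)
      (trans (proj₂ (atColour i t)) (trans (cong suc same-y) (sym (proj₂ (atColour i′ t′)))))

-- Embeddings between parts

yOf : (d : Fin k → ℕ) (i : Fin k) → Fin (d i) → Fin (maxv k d)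
yOf d i t = inject≤ t (≤maxv _ d i)

module _ {c : Decomp n k d} where

  leafVertex : ∀ {i j} → Leaves c i j → VertG k d
  leafVertex {i} (t , _) = inj₂ (yOf d i t)

  leaf-adj : ∀ {i j} (ℓ : Leaves c i j) → AdjPart c j (inj₁ i) (leafVertex ℓ)
  leaf-adj (t , p) = t , sym (toℕ-inject≤ t _) , p

  adj-leaf : ∀ {i j u} → AdjPart c j (inj₁ i) u → Σ (Leaves c i j) λ ℓ → u ≡ leafVertex ℓ
  adj-leaf {u = inj₂ y} (t , same-y , p) =
    (t , p) , cong inj₂ (toℕ-injective (trans (sym same-y) (sym (toℕ-inject≤ t _))))

  adj-sym : ∀ {j u v} → AdjPart c j u v → AdjPart c j v u
  adj-sym {u = inj₁ _} {inj₂ _} a = a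
  adj-sym {u = inj₂ _} {inj₁ _} a = a

  centre : ∀ {j u v} → AdjPart c j u v → Fin k
  centre {u = inj₁ i} {inj₂ _} _ = i
  centre {u = inj₂ _} {inj₁ i} _ = i

  centre-endpoint : ∀ {j u v} (a : AdjPart c j u v) → inj₁ (centre a) ≡ u ⊎ inj₁ (centre a) ≡ v
  centre-endpoint {u = inj₁ _} {inj₂ _} _ = inj₁ refl
  centre-endpoint {u = inj₂ _} {inj₁ _} _ = inj₂ refl

  leaf-injective : ∀ {i j} {ℓ ℓ′ : Leaves c i j} → leafVertex ℓ ≡ leafVertex ℓ′ → ℓ ≡ ℓ′
  leaf-injective eq = Σ-≡-irrelevant Fin-≡-irrelevant (inject≤-injective _ _ _ _ (inj₂-injective eq))

  module _ (ydeg : YDegAtMostOne c) where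

    neighbour-unique : ∀ {j y u u′} → AdjPart c j (inj₂ y) u → AdjPart c j (inj₂ y) u′ → u ≡ u′
    neighbour-unique {u = inj₁ i} {inj₁ i′} (t , e , p) (t′ , e′ , p′) =
      cong (inj₁ ∘ proj₁) (ydeg (i , t) (i′ , t′) (trans p (sym p′)) (trans e (sym e′)))

    shared-endpoint : ∀ {i i′ j u} (ℓ : Leaves c i j) (ℓ′ : Leaves c i′ j) →
                      inj₁ i ≡ u ⊎ leafVertex ℓ ≡ u → inj₁ i′ ≡ u ⊎ leafVertex ℓ′ ≡ u → i ≡ i′
    shared-endpoint _ _ (inj₁ e) (inj₁ e′) = inj₁-injective (trans e (sym e′))
    shared-endpoint {i} {i′} (t , p) (t′ , p′) (inj₂ e) (inj₂ e′) =
      cong proj₁ (ydeg (i , t) (i′ , t′) (trans p (sym p′)) same-y)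
      where
      same-y : toℕ t ≡ toℕ t′
      same-y = trans (sym (toℕ-inject≤ t _))
                     (trans (cong toℕ (inj₂-injective (trans e (sym e′)))) (toℕ-inject≤ t′ _))
    shared-endpoint _ _ (inj₁ e) (inj₂ e′) with trans e (sym e′)
    ... | ()
    shared-endpoint _ _ (inj₂ e) (inj₁ e′) with trans e (sym e′)
    ... | ()

    module _ {A : Matrix k n} (deg : DegreeMatrix c A) {j j′ : Fin n} where

      module EmbeddedStars (embedding : EmbedsInto c j j′) where

        φ : VertG k d → VertG k d
        φ = proj₁ embedding
        φ-injective : Injective _≡_ _≡_ φ
        φ-injective = proj₁ (proj₂ embedding)

        image : ∀ {i} (ℓ : Leaves c i j) → AdjPart c j′ (φ (inj₁ i)) (φ (leafVertex ℓ))
        image ℓ = proj₂ (proj₂ embedding) _ _ (leaf-adj ℓ)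

        star-into-star : ∀ {i i′} → φ (inj₁ i) ≡ inj₁ i′ → A i j ≤ A i′ j′
        star-into-star {i} {i′} eq = injection⇒≤ (↔-sym (deg i j)) (↔-sym (deg i′ j′)) moved moved-injective
          where
          moved-adj : ∀ ℓ → AdjPart c j′ (inj₁ i′) (φ (leafVertex ℓ))
          moved-adj ℓ = subst (λ u → AdjPart c j′ u (φ (leafVertex ℓ))) eq (image ℓ)
          moved : Leaves c i j → Leaves c i′ j′
          moved ℓ = proj₁ (adj-leaf (moved-adj ℓ))
          moved-injective : Injective _≡_ _≡_ moved
          moved-injective {ℓ} {ℓ′} eq′ = leaf-injective (φ-injective (begin
            φ (leafVertex ℓ)       ≡⟨ proj₂ (adj-leaf (moved-adj ℓ)) ⟩
            leafVertex (moved ℓ)   ≡⟨ cong leafVertex eq′ ⟩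
            leafVertex (moved ℓ′)  ≡⟨ proj₂ (adj-leaf (moved-adj ℓ′)) ⟨
            φ (leafVertex ℓ′)      ∎))
            where open ≡-Reasoning

        -- The leaves of x_i all go to neighbours of the Y-vertex φ x_i, and it has only one.
        star-into-leaf : ∀ {i y} → φ (inj₁ i) ≡ inj₂ y → A i j ≤ 1
        star-into-leaf {i} {y} eq = injection⇒≤ (↔-sym (deg i j)) (↔-id _) (λ _ → zero) λ {ℓ} {ℓ′} _ →
          leaf-injective (φ-injective (neighbour-unique (moved-adj ℓ) (moved-adj ℓ′)))
          where
          moved-adj : ∀ ℓ → AdjPart c j′ (inj₂ y) (φ (leafVertex ℓ))
          moved-adj ℓ = subst (λ u → AdjPart c j′ u (φ (leafVertex ℓ))) eq (image ℓ)

        centre-degree : ∀ {u v} (a : AdjPart c j′ u v) → 1 ≤ A (centre a) j′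
        centre-degree {inj₁ _} {inj₂ _} (t , _ , p) = ≤-trans (s≤s z≤n) (toℕ<n (from (deg _ j′) (t , p)))
        centre-degree {inj₂ y} {inj₁ i} a             = centre-degree {inj₁ i} {inj₂ y} a

        star-size-≤ : ∀ {i u v} (a : AdjPart c j′ u v) → φ (inj₁ i) ≡ u → A i j ≤ A (centre a) j′
        star-size-≤ {u = inj₁ _} {inj₂ _} _ eq = star-into-star eq
        star-size-≤ {u = inj₂ y} {inj₁ i} a eq = ≤-trans (star-into-leaf eq) (centre-degree {inj₂ y} {inj₁ i} a)

        first-leaf : ∀ {i} → 0 < A i j → Leaves c i j
        first-leaf {i} pos = to (deg i j) (fromℕ< pos)

        target : ∀ {i} → 0 < A i j → Fin k
        target pos = centre (image (first-leaf pos))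

        target-≤ : ∀ {i} (pos : 0 < A i j) → A i j ≤ A (target pos) j′
        target-≤ pos = star-size-≤ (image (first-leaf pos)) refl

        preimage : ∀ {i} (pos : 0 < A i j) →
                   Σ (VertG k d) λ u → (inj₁ i ≡ u ⊎ leafVertex (first-leaf pos) ≡ u) × φ u ≡ inj₁ (target pos)
        preimage pos with centre-endpoint (image (first-leaf pos))
        ... | inj₁ e = _ , inj₁ refl , sym e
        ... | inj₂ e = _ , inj₂ refl , sym e

        target-injective : ∀ {i i′} (pos : 0 < A i j) (pos′ : 0 < A i′ j) → target pos ≡ target pos′ → i ≡ i′
        target-injective pos pos′ eq with preimage pos | preimage pos′
        ... | _ , end , φu | _ , end′ , φu′ with φ-injective (trans φu (trans (cong inj₁ eq) (sym φu′)))
        ... | refl = shared-endpoint (first-leaf pos) (first-leaf pos′) end end′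

      embedsInto⇒⪯ : EmbedsInto c j j′ → column A j ⪯ column A j′
      embedsInto⇒⪯ embedding = #≥ᵛ-mono⇒⪯ dominated
        where
        open EmbeddedStars embedding
        positive : ∀ {w a} → suc w ≤ a → 0 < a
        positive = ≤-trans (s≤s z≤n)
        dominated : ∀ v → #≥ᵛ v (column A j) ≤ #≥ᵛ v (column A j′)
        dominated zero    = count-mono (λ i → 0 ≤? A i j) (λ i → 0 ≤? A i j′) ≤-irrelevant ≤-irrelevant
          (λ (i , _) → i , z≤n) id
        dominated (suc w) = count-mono (λ i → suc w ≤? A i j) (λ i → suc w ≤? A i j′) ≤-irrelevant ≤-irrelevant
          (λ (_ , w<) → target (positive w<) , ≤-trans w< (target-≤ (positive w<)))
          (λ {(_ , w<)} {(_ , w<′)} → target-injective (positive w<) (positive w<′))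

      module MovedStars (σ : Permutation k k) (σ-dominates : ∀ i → A i j ≤ A (σ ⟨$⟩ʳ i) j′) where

        Edges : Fin n → Set
        Edges j = Σ (Fin k) λ i → Fin (A i j)

        yEnd : ∀ {j} → Edges j → Fin (maxv k d)
        yEnd {j} (i , s) = yOf d i (proj₁ (to (deg i j) s))

        yEnd-injective : ∀ {j} → Injective _≡_ _≡_ (yEnd {j})
        yEnd-injective {j} {i , s} {i′ , s′} eq
          with cong proj₁ (ydeg (i , proj₁ (to (deg i j) s)) (i′ , proj₁ (to (deg i′ j) s′))
                            (trans (proj₂ (to (deg i j) s)) (sym (proj₂ (to (deg i′ j) s′))))
                            (trans (sym (toℕ-inject≤ _ _)) (trans (cong toℕ eq) (toℕ-inject≤ _ _))))
        ... | refl = cong (i ,_) (↔-to-injective (deg i j)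
                       (Σ-≡-irrelevant Fin-≡-irrelevant (inject≤-injective _ _ _ _ eq)))

        moved : Edges j → Edges j′
        moved (i , s) = σ ⟨$⟩ʳ i , inject≤ s (σ-dominates i)

        moved-injective : Injective _≡_ _≡_ moved
        moved-injective {_ , s} {_ , s′} eq = Σ-Fin-≡ (↔-to-injective σ (cong proj₁ eq))
          (trans (sym (toℕ-inject≤ s _)) (trans (cong (toℕ ∘ proj₂) eq) (toℕ-inject≤ s′ _)))

        ε : Edges j ↔ Fin (Σv k (column A j))
        ε = Σ-Fin-↔ k (column A j)

        extension : Σ (Permutation (maxv k d) (maxv k d)) λ π →
                      ∀ r → π ⟨$⟩ʳ yEnd (from ε r) ≡ yEnd (moved (from ε r))
        extension = extend-injection (yEnd ∘ from ε) (yEnd ∘ moved ∘ from ε)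
          (↔-to-injective (↔-sym ε) ∘ yEnd-injective)
          (↔-to-injective (↔-sym ε) ∘ moved-injective ∘ yEnd-injective)

        π : Permutation (maxv k d) (maxv k d)
        π = proj₁ extension

        π-moves : ∀ x → π ⟨$⟩ʳ yEnd x ≡ yEnd (moved x)
        π-moves x = subst (λ x′ → π ⟨$⟩ʳ yEnd x′ ≡ yEnd (moved x′)) (strictlyInverseʳ ε x)
                          (proj₂ extension (to ε x))

        φ : VertG k d → VertG k d
        φ (inj₁ i) = inj₁ (σ ⟨$⟩ʳ i)
        φ (inj₂ y) = inj₂ (π ⟨$⟩ʳ y)

        φ-injective : Injective _≡_ _≡_ φ
        φ-injective {inj₁ _} {inj₁ _} eq = cong inj₁ (↔-to-injective σ (inj₁-injective eq))
        φ-injective {inj₂ _} {inj₂ _} eq = cong inj₂ (↔-to-injective π (inj₂-injective eq))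
        φ-injective {inj₁ _} {inj₂ _} ()
        φ-injective {inj₂ _} {inj₁ _} ()

        star-adj : ∀ i u → AdjPart c j (inj₁ i) u → AdjPart c j′ (inj₁ (σ ⟨$⟩ʳ i)) (φ u)
        star-adj i u a with adj-leaf a
        ... | ℓ , refl = subst (λ y → AdjPart c j′ (inj₁ (σ ⟨$⟩ʳ i)) (inj₂ y)) (sym π-leaf)
                           (leaf-adj (to (deg _ j′) (proj₂ (moved (i , s)))))
          where
          s = from (deg i j) ℓ
          π-leaf : π ⟨$⟩ʳ yOf d i (proj₁ ℓ) ≡ yEnd (moved (i , s))
          π-leaf = trans (cong (λ ℓ′ → π ⟨$⟩ʳ yOf d i (proj₁ ℓ′)) (sym (strictlyInverseˡ (deg i j) ℓ)))
                         (π-moves (i , s))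

        φ-adj : ∀ u v → AdjPart c j u v → AdjPart c j′ (φ u) (φ v)
        φ-adj (inj₁ i) v        a = star-adj i v a
        φ-adj (inj₂ y) (inj₁ i) a =
          adj-sym {u = inj₁ _} {inj₂ _} (star-adj i (inj₂ y) (adj-sym {u = inj₂ y} {inj₁ i} a))

      ⪯⇒embedsInto : column A j ⪯ column A j′ → EmbedsInto c j j′
      ⪯⇒embedsInto col⪯ = φ , φ-injective , φ-adj
        where open MovedStars (proj₁ (⪯⇒dominating-permutation col⪯)) (proj₂ (⪯⇒dominating-permutation col⪯))

ColouredAscendingMatrix : (n k : ℕ) → (Fin k → ℕ) → Set
ColouredAscendingMatrix n k d = Σ (Matrix k n) λ A → Ascending n k d A × SequentialColouring d A

asd⇒colouredAscendingMatrix : XCentredStarASD n k d → ColouredAscendingMatrix n k d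
asd⇒colouredAscendingMatrix {n} {k} {d} (c , sizes , embeds , _ , ydeg) =
  A , ((numbering⇒rowSums κ , columnSums) , ascending) , numbering⇒sequential κ ydeg
  where
  -- partOf κ reduces to c, so ydeg also serves as YDegAtMostOne (partOf κ) above.
  A : Matrix k n
  A i j = count (λ t → c (i , t) ≟ j)
  deg : DegreeMatrix c A
  deg i j = ↔-sym (count-↔ (λ t → c (i , t) ≟ j) Fin-≡-irrelevant)
  κ : Numbering d A
  κ = degreeMatrix⇒numbering deg
  columnSums : ∀ j → Σv k (column A j) ≡ suc (toℕ j)
  columnSums j = ↔⇒≡ (↔-trans (↔-sym (part-↔ deg j)) (sizes j))
  ascending : ∀ j j′ → Next j j′ → column A j ⪯ column A j′
  ascending j j′ next = embedsInto⇒⪯ ydeg deg (embeds j j′ next)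

colouredAscendingMatrix⇒asd : ColouredAscendingMatrix n k d → XCentredStarASD n k d
colouredAscendingMatrix⇒asd {n} {k} {d} (A , ((_ , columnSums) , ascending) , colouring) =
  asd (sequential⇒numbering colouring)
  where
  asd : Σ (Numbering d A) (λ κ → YDegAtMostOne (partOf κ)) → XCentredStarASD n k d
  asd (κ , ydeg) = partOf κ , sizes , embeds , (λ g → inj₁ λ g′ → ydeg g′ g) , ydeg
    where
    sizes : ∀ j → PartSize (partOf κ) j
    sizes j = ↔-trans (part-↔ (partOf-degreeMatrix κ) j) (cast-id (columnSums j))
    embeds : ∀ j j′ → Next j j′ → EmbedsInto (partOf κ) j j′
    embeds j j′ next = ⪯⇒embedsInto ydeg (partOf-degreeMatrix κ) (ascending j j′ next)

proposition1 : (n k : ℕ) (d : Fin k → ℕ) →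
    1 ≤ n →
    (∀ i → 1 ≤ d i) →
    (∀ i i' → Data.Fin._≤_ i i' → d i ≤ d i') →
    Σv k d ≡ suc n C 2 →
    XCentredStarASD n k d ⇔ (Σ (Matrix k n) λ A → Ascending n k d A × SequentialColouring d A)
proposition1 n k d _ _ _ _ = mk⇔ asd⇒colouredAscendingMatrix colouredAscendingMatrix⇒asd
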